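{- Let $r \ge 1$ and $n \ge 1$ be integers, and let \[ P_r^n := \left\{ (\lambda_1, \dots , \lambda_n) \in \mathbb{Z}^n : \, \sum_{ j=0 }^t (-1)^j \binom t j \lambda_{ k+j } \ge 0 \ \text{ for } \ 1 \le k \le n, \ 1 \le t \le r \right\}, \] where $\lambda_m := 0$ for $m > n$. Then, as formal power series in $z_1,\dots,z_n$, \[ \sum_{(\lambda_1,\dots,\lambda_n) \in P_r^n} z_1^{\lambda_1} \cdots z_n^{\lambda_n} = \prod_{i=1}^{n} \frac{1}{1 - \prod_{m=1}^{i} z_m^{\binom{r+i-m-1}{r-1}}} , \] that is, \[ \frac{ 1 }{ \left( 1 - z_1 \right) \left( 1 - z_1^r z_2 \right) \left( 1 - z_1^{ \binom{ r+1 }{ r-1 } } z_2^r z_3 \right) \left( 1 - z_1^{ \binom{ r+2 }{ r-1 } } z_2^{ \binom{ r+1 }{ r-1 } } z_3^r z_4 \right) \cdots \left( 1 - z_1^{ \binom{ r+n-2 }{ r-1 } } z_2^{ \binom{ r+n-3 }{ r-1 } } \cdots z_{ n-1 }^r z_n \right) } . \]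
   Context: In the defining inequalities of $P_r^n$, any $\lambda_m$ with index $m > n$ is interpreted as $0$. -}

module Defs where

open import Data.Nat as ℕ using (ℕ; zero; suc; _∸_; _≤ᵇ_)
open import Data.Nat.Combinatorics using (_C_)
open import Data.Integer as ℤ using (ℤ; +_; _≤_)
open import Data.Fin using (Fin; zero; suc; toℕ)
open import Data.Fin.Properties using (all?)
open import Data.Vec.Functional using (head; tail) renaming (_∷_ to _∷ᵥ_)
open import Data.List using (List; []; _∷_; map; foldr; concatMap; upTo)
open import Data.Product using (_×_; _,_)
open import Data.Bool using (Bool; true; false; if_then_else_; _∧_)
open import Relation.Nullary using (Dec; does)
open import Relation.Binary.PropositionalEquality using (_≡_)

-- λ_m (0-based index here: ext λ i = λ_{i+1}), with λ_m := 0 for m > n.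
ext : ∀ {n} → (Fin n → ℤ) → ℕ → ℤ
ext {zero}  λ' i       = + 0
ext {suc n} λ' zero    = λ' zero
ext {suc n} λ' (suc i) = ext (λ' ∘' suc) i
  where
  _∘'_ : {A B C : Set} → (B → C) → (A → B) → A → C
  (f ∘' g) x = f (g x)

sumℤ : List ℤ → ℤ
sumℤ = foldr ℤ._+_ (+ 0)

sign : ℕ → ℤ
sign zero          = + 1
sign (suc zero)    = ℤ.- (+ 1)
sign (suc (suc j)) = sign j

-- Σ_{j=0}^{t} (-1)^j C(t,j) λ_{k+j}, with k 1-based.
diffSum : ∀ {n} → (Fin n → ℤ) → (k t : ℕ) → ℤ
diffSum λ' k t =
  sumℤ (map (λ j → sign j ℤ.* (+ (t C j)) ℤ.* ext λ' (k ∸ 1 ℕ.+ j)) (upTo (suc t)))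

InP : (r : ℕ) → ∀ {n} → (Fin n → ℤ) → Set
InP r {n} λ' = (k : Fin n) (t : Fin r) → + 0 ≤ diffSum λ' (suc (toℕ k)) (suc (toℕ t))

InP? : (r : ℕ) → ∀ {n} → (λ' : Fin n → ℤ) → Dec (InP r λ')
InP? r λ' = all? (λ k → all? (λ t → + 0 ℤ.≤? diffSum λ' (suc (toℕ k)) (suc (toℕ t))))

-- Formal power series in z_1..z_n with integer coefficients:
-- a series is its coefficient function on exponent vectors in ℕ^n.

Series : ℕ → Set
Series n = (Fin n → ℕ) → ℤ

splits : ∀ {n} → (Fin n → ℕ) → List ((Fin n → ℕ) × (Fin n → ℕ))
splits {zero}  α = ((λ ()) , (λ ())) ∷ []
splits {suc n} α =
  concatMap (λ b → map (λ { (β , γ) → (b ∷ᵥ β) , ((head α ∸ b) ∷ᵥ γ) }) (splits (tail α)))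
            (upTo (suc (head α)))

_*ₛ_ : ∀ {n} → Series n → Series n → Series n
(f *ₛ g) α = sumℤ (map (λ { (β , γ) → f β ℤ.* g γ }) (splits α))

_-ₛ_ : ∀ {n} → Series n → Series n → Series n
(f -ₛ g) α = f α ℤ.- g α

eqVecᵇ : ∀ {n} → (Fin n → ℕ) → (Fin n → ℕ) → Bool
eqVecᵇ {zero}  α β = true
eqVecᵇ {suc n} α β = (head α ℕ.≡ᵇ head β) ∧ eqVecᵇ (tail α) (tail β)

mono : ∀ {n} → (Fin n → ℕ) → Series n
mono v α = if eqVecᵇ α v then + 1 else + 0

oneₛ : ∀ {n} → Series n
oneₛ = mono (λ _ → 0)

prodₛ : ∀ {n} → (k : ℕ) → (ℕ → Series n) → Series n
prodₛ zero    F = oneₛ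
prodₛ (suc k) F = prodₛ k F *ₛ F k

_≈ₛ_ : ∀ {n} → Series n → Series n → Set
f ≈ₛ g = ∀ α → f α ≡ g α

-- Σ_{λ ∈ P_r^n ∩ ℕ^n} z^λ
lhsSeries : (r n : ℕ) → Series n
lhsSeries r n α = if does (InP? r (λ i → + (α i))) then + 1 else + 0

-- exponent vector of the i-th factor (0-based i, i.e. factor i+1 of the paper):
-- z_{m+1} has exponent C(r+(i+1)-(m+1)-1, r-1) = C((r-1)+(i-m), r-1) if m ≤ i, else 0.
factorExp : (r n : ℕ) → ℕ → Fin n → ℕ
factorExp r n i m =
  if toℕ m ≤ᵇ i then ((r ∸ 1) ℕ.+ (i ∸ toℕ m)) C (r ∸ 1) else 0

factor : (r n : ℕ) → ℕ → Series n
factor r n i = oneₛ -ₛ mono (factorExp r n i)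

{-# OPTIONS --safe #-}
-- The coordinates c = Δ^r λ, c_j = Σ_t (-1)^t C(r,t) λ_{j+t} (with λ_m = 0 beyond n), form a
-- unimodular change of variables on ℤ^n, and λ ∈ P_r^n iff c ≥ 0: the inequalities of order
-- t < r follow from those of order r by summing differences down from n, and they give λ ≥ 0.
-- By Pascal's rule the exponent vector v_k of the k-th factor, with entries C(r-1+k-m, r-1),
-- has coordinates c = e_k. So P_r^n = ℕ v_1 ⊕ ⋯ ⊕ ℕ v_n, and inductively, multiplying its
-- generating series by (1 - z^{v_1}) ⋯ (1 - z^{v_k}) leaves the indicator of the points of
-- P_r^n whose first k coordinates vanish; for k = n this is the point 0.

module Submission where

open import Defs
open import Data.Nat using (ℕ; _≤_)
open import Data.Integer using (ℤ; +_) renaming (_≤_ to _≤ℤ_)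
open import Data.Fin using (Fin)
open import Data.Product using (_×_)

open import Data.Nat as ℕ using (zero; suc; _∸_; _≤ᵇ_; _≡ᵇ_; _<_; z≤n; s≤s)
import Data.Nat.Properties as NP
open import Data.Nat.Combinatorics using (_C_; nCn≡1; nCk≡nC[n∸k]; k>n⇒nCk≡0; nCk+nC[k+1]≡[n+1]C[k+1])
open import Data.Integer as ℤ using (_+_; _*_; -_; _-_)
import Data.Integer.Properties as ZP
open import Data.Integer.Solver using (module +-*-Solver)
open import Data.Fin using (zero; suc; toℕ; fromℕ; fromℕ<)
import Data.Fin.Properties as FP
open import Data.Vec.Functional using (head; tail) renaming (_∷_ to _∷ᵥ_)
open import Data.List using (List; []; _∷_; map; concatMap; upTo; applyUpTo; _++_)
import Data.List.Properties as LP
open import Data.Product using (_,_; proj₁; proj₂; Σ-syntax)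
import Data.Sum as Sum
open import Data.Bool using (Bool; true; false; if_then_else_; _∧_; T)
open import Data.Bool.Properties using (T-∧)
open import Data.Empty using (⊥-elim)
open import Function using (_∘_; Equivalence; _⇔_; mk⇔)
open import Relation.Binary using (tri<; tri≈; tri>)
open import Relation.Nullary using (¬_; Dec; yes; no; does; _because_; _×-dec_; _→-dec_)
open import Relation.Nullary.Decidable using (dec-true; dec-false; does-⇔)
import Relation.Nullary.Decidable as Dec
open import Relation.Nullary.Reflects using (Reflects; ofʸ; ofⁿ; fromEquivalence)
open import Relation.Binary.PropositionalEquality

open +-*-Solver using (solve; _:+_; _:-_; :-_; _:*_; _:=_; con)
open Equivalence using (to; from)

≤ᵇ-true : ∀ {m n} → m ≤ n → (m ≤ᵇ n) ≡ true
≤ᵇ-true {m} {n} = dec-true (m ℕ.≤? n)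

≤ᵇ-false : ∀ {m n} → ¬ m ≤ n → (m ≤ᵇ n) ≡ false
≤ᵇ-false {m} {n} = dec-false (m ℕ.≤? n)

≡ᵇ-true : ∀ {m n} → m ≡ n → (m ≡ᵇ n) ≡ true
≡ᵇ-true {m} {n} = dec-true (m ℕ.≟ n)

≡ᵇ-false : ∀ {m n} → m ≢ n → (m ≡ᵇ n) ≡ false
≡ᵇ-false {m} {n} = dec-false (m ℕ.≟ n)

*-distribˡ-minus : ∀ a x y → a * (x - y) ≡ a * x - a * y
*-distribˡ-minus = solve 3 (λ a x y → a :* (x :- y) := a :* x :- a :* y) refl

indicator : Bool → ℤ
indicator b = if b then + 1 else + 0

sumTo : ℕ → (ℕ → ℤ) → ℤ
sumTo zero    g = + 0
sumTo (suc m) g = g 0 + sumTo m (g ∘ suc)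

sumTo-cong : ∀ m {g h : ℕ → ℤ} → (∀ j → g j ≡ h j) → sumTo m g ≡ sumTo m h
sumTo-cong zero    g≗h = refl
sumTo-cong (suc m) g≗h = cong₂ _+_ (g≗h 0) (sumTo-cong m (g≗h ∘ suc))

sumTo-zero : ∀ m {g : ℕ → ℤ} → (∀ j → g j ≡ + 0) → sumTo m g ≡ + 0
sumTo-zero zero    g≗0 = refl
sumTo-zero (suc m) g≗0 = cong₂ _+_ (g≗0 0) (sumTo-zero m (g≗0 ∘ suc))

sumTo-+ : ∀ m (g h : ℕ → ℤ) → sumTo m (λ j → g j + h j) ≡ sumTo m g + sumTo m h
sumTo-+ zero    g h = refl
sumTo-+ (suc m) g h = trans (cong (_+_ (g 0 + h 0)) (sumTo-+ m (g ∘ suc) (h ∘ suc)))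
  (solve 4 (λ a b c d → (a :+ b) :+ (c :+ d) := (a :+ c) :+ (b :+ d)) refl (g 0) (h 0) _ _)

sumTo-neg : ∀ m (g : ℕ → ℤ) → sumTo m (λ j → - g j) ≡ - sumTo m g
sumTo-neg zero    g = refl
sumTo-neg (suc m) g = trans (cong (_+_ (- g 0)) (sumTo-neg m (g ∘ suc))) (sym (ZP.neg-distrib-+ (g 0) _))

sumTo-snoc : ∀ m (g : ℕ → ℤ) → sumTo (suc m) g ≡ sumTo m g + g m
sumTo-snoc zero    g = ZP.+-comm (g 0) (+ 0)
sumTo-snoc (suc m) g = trans (cong (_+_ (g 0)) (sumTo-snoc m (g ∘ suc))) (sym (ZP.+-assoc (g 0) _ _))

sumℤ-++ : ∀ xs ys → sumℤ (xs ++ ys) ≡ sumℤ xs + sumℤ ys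
sumℤ-++ []       ys = sym (ZP.+-identityˡ _)
sumℤ-++ (x ∷ xs) ys = trans (cong (_+_ x) (sumℤ-++ xs ys)) (sym (ZP.+-assoc x _ _))

sumℤ-concatMap : ∀ {A B : Set} (F : B → ℤ) (g : A → List B) xs →
  sumℤ (map F (concatMap g xs)) ≡ sumℤ (map (λ x → sumℤ (map F (g x))) xs)
sumℤ-concatMap F g []       = refl
sumℤ-concatMap F g (x ∷ xs) = begin
  sumℤ (map F (g x ++ concatMap g xs))               ≡⟨ cong sumℤ (LP.map-++ F (g x) _) ⟩
  sumℤ (map F (g x) ++ map F (concatMap g xs))       ≡⟨ sumℤ-++ (map F (g x)) _ ⟩
  sumℤ (map F (g x)) + sumℤ (map F (concatMap g xs)) ≡⟨ cong (_+_ (sumℤ (map F (g x)))) (sumℤ-concatMap F g xs) ⟩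
  _                                                  ∎
  where open ≡-Reasoning

sumℤ-upTo : ∀ (h : ℕ → ℤ) m → sumℤ (map h (upTo m)) ≡ sumTo m h
sumℤ-upTo h m = trans (cong sumℤ (LP.map-upTo h m)) (go h m)
  where
  go : ∀ (h : ℕ → ℤ) m → sumℤ (applyUpTo h m) ≡ sumTo m h
  go h zero    = refl
  go h (suc m) = cong (_+_ (h 0)) (go (h ∘ suc) m)

sumℤ-map-zero : ∀ {A : Set} (xs : List A) → sumℤ (map (λ _ → + 0) xs) ≡ + 0
sumℤ-map-zero []       = refl
sumℤ-map-zero (x ∷ xs) = cong (_+_ (+ 0)) (sumℤ-map-zero xs)

sumℤ-map-minus : ∀ {A : Set} (F G : A → ℤ) xs →
  sumℤ (map (λ x → F x - G x) xs) ≡ sumℤ (map F xs) - sumℤ (map G xs)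
sumℤ-map-minus F G []       = refl
sumℤ-map-minus F G (x ∷ xs) = trans (cong (_+_ (F x - G x)) (sumℤ-map-minus F G xs))
  (solve 4 (λ a b c d → (a :- b) :+ (c :- d) := (a :+ c) :- (b :+ d)) refl (F x) (G x) _ _)

sumTo-antidiagonal-point : ∀ a w (H : ℕ → ℕ → ℤ) →
  sumTo (suc a) (λ b → if (a ∸ b) ≡ᵇ w then H b (a ∸ b) else + 0)
  ≡ (if w ≤ᵇ a then H (a ∸ w) w else + 0)
sumTo-antidiagonal-point zero    zero    H = ZP.+-identityʳ _
sumTo-antidiagonal-point zero    (suc w) H = refl
sumTo-antidiagonal-point (suc a) w H
  with sumTo-antidiagonal-point a w (H ∘ suc) | ℕ.<-cmp w (suc a)
... | ih | tri< w<1+a _ _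
  rewrite ≡ᵇ-false (NP.>⇒≢ w<1+a) | ≤ᵇ-true (ℕ.s≤s⁻¹ w<1+a) | ≤ᵇ-true (NP.<⇒≤ w<1+a)
        | NP.+-∸-assoc 1 (ℕ.s≤s⁻¹ w<1+a) = trans (ZP.+-identityˡ _) ih
... | ih | tri≈ _ refl _
  rewrite ≡ᵇ-true {a} refl | ≤ᵇ-false (NP.n≮n a) | ≤ᵇ-true (NP.≤-refl {suc a}) | NP.n∸n≡0 a
  = trans (cong (_+_ (H 0 (suc a))) ih) (ZP.+-identityʳ _)
... | ih | tri> _ _ 1+a<w
  rewrite ≡ᵇ-false (NP.<⇒≢ 1+a<w) | ≤ᵇ-false (NP.<⇒≱ 1+a<w) | ≤ᵇ-false (NP.<⇒≱ (NP.<-trans (NP.n<1+n a) 1+a<w))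
  = trans (ZP.+-identityˡ _) ih

sumTo-antidiagonal-shift : ∀ a v (K : ℕ → ℕ → ℤ) →
  sumTo (suc a) (λ b → if v ≤ᵇ (a ∸ b) then K b ((a ∸ b) ∸ v) else + 0)
  ≡ (if v ≤ᵇ a then sumTo (suc (a ∸ v)) (λ b → K b ((a ∸ v) ∸ b)) else + 0)
sumTo-antidiagonal-shift zero    zero    K = refl
sumTo-antidiagonal-shift zero    (suc v) K = refl
sumTo-antidiagonal-shift (suc a) v K
  with sumTo-antidiagonal-shift a v (K ∘ suc) | ℕ.<-cmp v (suc a)
... | ih | tri< v<1+a _ _
  rewrite ≤ᵇ-true (ℕ.s≤s⁻¹ v<1+a) | ≤ᵇ-true (NP.<⇒≤ v<1+a) | NP.+-∸-assoc 1 (ℕ.s≤s⁻¹ v<1+a)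
  = cong (_+_ (K 0 (suc (a ∸ v)))) ih
... | ih | tri≈ _ refl _
  rewrite ≤ᵇ-true (NP.≤-refl {suc a}) | ≤ᵇ-false (NP.n≮n a) | NP.n∸n≡0 a
  = cong (_+_ (K 0 0)) ih
... | ih | tri> _ _ 1+a<v
  rewrite ≤ᵇ-false (NP.<⇒≱ 1+a<v) | ≤ᵇ-false (NP.<⇒≱ (NP.<-trans (NP.n<1+n a) 1+a<v))
  = trans (ZP.+-identityˡ _) ih

Exp : ℕ → Set
Exp n = Fin n → ℕ

toℤ : ∀ {n} → Exp n → Fin n → ℤ
toℤ α i = + α i

_∸ᵥ_ : ∀ {n} → Exp n → Exp n → Exp n
(α ∸ᵥ β) i = α i ∸ β i

_≤ᵥᵇ_ : ∀ {n} → Exp n → Exp n → Bool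
_≤ᵥᵇ_ {zero}  v α = true
_≤ᵥᵇ_ {suc n} v α = (head v ≤ᵇ head α) ∧ (tail v ≤ᵥᵇ tail α)

_≤ᵥ_ : ∀ {n} → Exp n → Exp n → Set
v ≤ᵥ α = ∀ i → v i ≤ α i

≤ᵥᵇ-reflects : ∀ {n} (v α : Exp n) → Reflects (v ≤ᵥ α) (v ≤ᵥᵇ α)
≤ᵥᵇ-reflects v α = fromEquivalence (sound v α) (complete v α)
  where
  sound : ∀ {n} (v α : Exp n) → T (v ≤ᵥᵇ α) → v ≤ᵥ α
  sound {suc n} v α t zero    = NP.≤ᵇ⇒≤ _ _ (proj₁ (to T-∧ t))
  sound {suc n} v α t (suc i) = sound (tail v) (tail α) (proj₂ (to (T-∧ {head v ≤ᵇ head α}) t)) i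
  complete : ∀ {n} (v α : Exp n) → v ≤ᵥ α → T (v ≤ᵥᵇ α)
  complete {zero}  v α le = _
  complete {suc n} v α le = from T-∧ (NP.≤⇒≤ᵇ (le zero) , complete (tail v) (tail α) (le ∘ suc))

eqVecᵇ-reflects : ∀ {n} (α w : Exp n) → Reflects (α ≗ w) (eqVecᵇ α w)
eqVecᵇ-reflects α w = fromEquivalence (sound α w) (complete α w)
  where
  sound : ∀ {n} (α w : Exp n) → T (eqVecᵇ α w) → α ≗ w
  sound {suc n} α w t zero    = NP.≡ᵇ⇒≡ _ _ (proj₁ (to T-∧ t))
  sound {suc n} α w t (suc i) = sound (tail α) (tail w) (proj₂ (to (T-∧ {head α ≡ᵇ head w}) t)) i
  complete : ∀ {n} (α w : Exp n) → α ≗ w → T (eqVecᵇ α w)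
  complete {zero}  α w eq = _
  complete {suc n} α w eq = from T-∧ (NP.≡⇒≡ᵇ _ _ (eq zero) , complete (tail α) (tail w) (eq ∘ suc))

∷-cong : ∀ {n} b {β β' : Exp n} → β ≗ β' → (b ∷ᵥ β) ≗ (b ∷ᵥ β')
∷-cong b eq zero    = refl
∷-cong b eq (suc i) = eq i

-- Without function extensionality, every series we handle is shown to respect ≗.
Respects≗ : ∀ {n} → (Exp n → ℤ) → Set
Respects≗ f = ∀ {β β'} → β ≗ β' → f β ≡ f β'

Respects₂≗ : ∀ {n} → (Exp n → Exp n → ℤ) → Set
Respects₂≗ Φ = ∀ {β β' γ γ'} → β ≗ β' → γ ≗ γ' → Φ β γ ≡ Φ β' γ'

-- (f *ₛ g) α is definitionally sumSplits α (λ β γ → f β * g γ).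
sumSplits : ∀ {n} → Exp n → (Exp n → Exp n → ℤ) → ℤ
sumSplits α Φ = sumℤ (map (λ p → Φ (proj₁ p) (proj₂ p)) (splits α))

sumSplits-cong : ∀ {n} (α : Exp n) {Φ Ψ : Exp n → Exp n → ℤ} →
  (∀ β γ → Φ β γ ≡ Ψ β γ) → sumSplits α Φ ≡ sumSplits α Ψ
sumSplits-cong α eq = cong sumℤ (LP.map-cong (λ p → eq (proj₁ p) (proj₂ p)) (splits α))

sumSplits-zero : ∀ {n} (α : Exp n) → sumSplits α (λ _ _ → + 0) ≡ + 0
sumSplits-zero α = sumℤ-map-zero (splits α)

sumSplits-minus : ∀ {n} (α : Exp n) (Φ Ψ : Exp n → Exp n → ℤ) →
  sumSplits α (λ β γ → Φ β γ - Ψ β γ) ≡ sumSplits α Φ - sumSplits α Ψ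
sumSplits-minus α Φ Ψ = sumℤ-map-minus (λ p → Φ (proj₁ p) (proj₂ p)) (λ p → Ψ (proj₁ p) (proj₂ p)) (splits α)

sumSplits-suc : ∀ {n} (α : Exp (suc n)) (Φ : Exp (suc n) → Exp (suc n) → ℤ) → sumSplits α Φ ≡
  sumTo (suc (head α)) (λ b → sumSplits (tail α) (λ β γ → Φ (b ∷ᵥ β) ((head α ∸ b) ∷ᵥ γ)))
sumSplits-suc {n} α Φ = begin
  sumℤ (map P (concatMap piece (upTo (suc (head α)))))
    ≡⟨ sumℤ-concatMap P piece (upTo (suc (head α))) ⟩
  sumℤ (map (λ b → sumℤ (map P (piece b))) (upTo (suc (head α))))
    ≡⟨ cong sumℤ (LP.map-cong (λ b → cong sumℤ (sym (LP.map-∘ (splits (tail α))))) (upTo (suc (head α)))) ⟩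
  sumℤ (map inner (upTo (suc (head α))))
    ≡⟨ sumℤ-upTo inner (suc (head α)) ⟩
  sumTo (suc (head α)) inner
    ∎
  where
  open ≡-Reasoning
  P : Exp (suc n) × Exp (suc n) → ℤ
  P p = Φ (proj₁ p) (proj₂ p)
  piece : ℕ → List (Exp (suc n) × Exp (suc n))
  piece b = map (λ { (β , γ) → (b ∷ᵥ β) , ((head α ∸ b) ∷ᵥ γ) }) (splits (tail α))
  inner : ℕ → ℤ
  inner b = sumSplits (tail α) (λ β γ → Φ (b ∷ᵥ β) ((head α ∸ b) ∷ᵥ γ))

sumSplits-respects : ∀ {n} (Φ : Exp n → Exp n → ℤ) → Respects₂≗ Φ →
  ∀ {α α'} → α ≗ α' → sumSplits α Φ ≡ sumSplits α' Φ
sumSplits-respects {zero}  Φ resp eq = refl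
sumSplits-respects {suc n} Φ resp {α} {α'} eq
  rewrite sumSplits-suc α Φ | sumSplits-suc α' Φ | eq zero =
  sumTo-cong (suc (head α')) λ b →
    sumSplits-respects (λ β γ → Φ (b ∷ᵥ β) ((α' zero ∸ b) ∷ᵥ γ))
      (λ eq₁ eq₂ → resp (∷-cong b eq₁) (∷-cong _ eq₂)) (eq ∘ suc)

sumSplits-point : ∀ {n} (α w : Exp n) (Φ : Exp n → Exp n → ℤ) → Respects₂≗ Φ →
  sumSplits α (λ β γ → Φ β γ * mono w γ) ≡ (if w ≤ᵥᵇ α then Φ (α ∸ᵥ w) w else + 0)
sumSplits-point {zero} α w Φ resp =
  trans (ZP.+-identityʳ _) (trans (ZP.*-identityʳ _) (resp (λ ()) (λ ())))
sumSplits-point {suc n} α w Φ resp = begin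
  sumSplits α (λ β γ → Φ β γ * mono w γ)
    ≡⟨ sumSplits-suc α _ ⟩
  sumTo (suc (head α)) (λ b → sumSplits (tail α) (λ β γ → Φ (b ∷ᵥ β) ((head α ∸ b) ∷ᵥ γ) * mono w ((head α ∸ b) ∷ᵥ γ)))
    ≡⟨ sumTo-cong (suc (head α)) (λ b → slice b ((head α ∸ b) ≡ᵇ head w)) ⟩
  sumTo (suc (head α)) (λ b → if (head α ∸ b) ≡ᵇ head w then H b (head α ∸ b) else + 0)
    ≡⟨ sumTo-antidiagonal-point (head α) (head w) H ⟩
  (if head w ≤ᵇ head α then H (head α ∸ head w) (head w) else + 0)
    ≡⟨ assemble ⟩
  (if w ≤ᵥᵇ α then Φ (α ∸ᵥ w) w else + 0)
    ∎
  where
  open ≡-Reasoning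
  H : ℕ → ℕ → ℤ
  H b c = if tail w ≤ᵥᵇ tail α then Φ (b ∷ᵥ (tail α ∸ᵥ tail w)) (c ∷ᵥ tail w) else + 0
  slice : ∀ b p → sumSplits (tail α)
            (λ β γ → Φ (b ∷ᵥ β) ((head α ∸ b) ∷ᵥ γ) * (if p ∧ eqVecᵇ γ (tail w) then + 1 else + 0))
          ≡ (if p then H b (head α ∸ b) else + 0)
  slice b true  = sumSplits-point (tail α) (tail w) (λ β γ → Φ (b ∷ᵥ β) ((head α ∸ b) ∷ᵥ γ))
                    (λ eq₁ eq₂ → resp (∷-cong b eq₁) (∷-cong _ eq₂))
  slice b false = trans (sumSplits-cong (tail α) (λ β γ → ZP.*-zeroʳ (Φ (b ∷ᵥ β) _))) (sumSplits-zero (tail α))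
  assemble : (if head w ≤ᵇ head α then H (head α ∸ head w) (head w) else + 0)
           ≡ (if w ≤ᵥᵇ α then Φ (α ∸ᵥ w) w else + 0)
  assemble with head w ≤ᵇ head α
  ... | false = refl
  ... | true with tail w ≤ᵥᵇ tail α
  ...   | false = refl
  ...   | true  = resp (λ { zero → refl ; (suc i) → refl }) (λ { zero → refl ; (suc i) → refl })

if-cong : ∀ (p : Bool) {x y z : ℤ} → x ≡ y → (if p then x else z) ≡ (if p then y else z)
if-cong true  eq = eq
if-cong false eq = refl

sumSplits-shift : ∀ {n} (α v : Exp n) (Φ : Exp n → Exp n → ℤ) → Respects₂≗ Φ →
  sumSplits α (λ β γ → if v ≤ᵥᵇ γ then Φ β (γ ∸ᵥ v) else + 0)
  ≡ (if v ≤ᵥᵇ α then sumSplits (α ∸ᵥ v) Φ else + 0)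
sumSplits-shift {zero} α v Φ resp = cong (_+ + 0) (resp (λ ()) (λ ()))
sumSplits-shift {suc n} α v Φ resp = begin
  sumSplits α (λ β γ → if v ≤ᵥᵇ γ then Φ β (γ ∸ᵥ v) else + 0)
    ≡⟨ sumSplits-suc α _ ⟩
  sumTo (suc (head α)) (λ b → sumSplits (tail α) (λ β γ →
    if (head v ≤ᵇ (head α ∸ b)) ∧ (tail v ≤ᵥᵇ γ) then Φ (b ∷ᵥ β) (((head α ∸ b) ∷ᵥ γ) ∸ᵥ v) else + 0))
    ≡⟨ sumTo-cong (suc (head α)) (λ b → slice b (head v ≤ᵇ (head α ∸ b))) ⟩
  sumTo (suc (head α)) (λ b → if head v ≤ᵇ (head α ∸ b) then K b ((head α ∸ b) ∸ head v) else + 0)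
    ≡⟨ sumTo-antidiagonal-shift (head α) (head v) K ⟩
  (if head v ≤ᵇ head α then sumTo (suc (head α ∸ head v)) (λ b → K b ((head α ∸ head v) ∸ b)) else + 0)
    ≡⟨ assemble ⟩
  (if v ≤ᵥᵇ α then sumSplits (α ∸ᵥ v) Φ else + 0)
    ∎
  where
  open ≡-Reasoning
  K : ℕ → ℕ → ℤ
  K b c = if tail v ≤ᵥᵇ tail α then sumSplits (tail α ∸ᵥ tail v) (λ β δ → Φ (b ∷ᵥ β) (c ∷ᵥ δ)) else + 0
  slice : ∀ b p → sumSplits (tail α) (λ β γ →
              if p ∧ (tail v ≤ᵥᵇ γ) then Φ (b ∷ᵥ β) (((head α ∸ b) ∷ᵥ γ) ∸ᵥ v) else + 0)
          ≡ (if p then K b ((head α ∸ b) ∸ head v) else + 0)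
  slice b true  =
    trans (sumSplits-cong (tail α) (λ β γ → if-cong (tail v ≤ᵥᵇ γ) (resp (λ _ → refl) (λ { zero → refl ; (suc i) → refl }))))
          (sumSplits-shift (tail α) (tail v) (λ β δ → Φ (b ∷ᵥ β) (((head α ∸ b) ∸ head v) ∷ᵥ δ))
            (λ eq₁ eq₂ → resp (∷-cong b eq₁) (∷-cong _ eq₂)))
  slice b false = sumSplits-zero (tail α)
  assemble : (if head v ≤ᵇ head α then sumTo (suc (head α ∸ head v)) (λ b → K b ((head α ∸ head v) ∸ b)) else + 0)
           ≡ (if v ≤ᵥᵇ α then sumSplits (α ∸ᵥ v) Φ else + 0)
  assemble with head v ≤ᵇ head α
  ... | false = refl
  ... | true with tail v ≤ᵥᵇ tail α
  ...   | false = sumTo-zero (suc (head α ∸ head v)) (λ _ → refl)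
  ...   | true  = sym (sumSplits-suc (α ∸ᵥ v) Φ)

eqVecᵇ-respects : ∀ {n} (w : Exp n) {α α'} → α ≗ α' → eqVecᵇ α w ≡ eqVecᵇ α' w
eqVecᵇ-respects w {α} {α'} eq = does-⇔
  (mk⇔ (λ α≗w i → trans (sym (eq i)) (α≗w i)) (λ α'≗w i → trans (eq i) (α'≗w i)))
  (_ because eqVecᵇ-reflects α w) (_ because eqVecᵇ-reflects α' w)

mono-respects : ∀ {n} (w : Exp n) → Respects≗ (mono w)
mono-respects w eq = cong indicator (eqVecᵇ-respects w eq)

*ₛ-respects : ∀ {n} {f g : Series n} → Respects≗ f → Respects≗ g → Respects≗ (f *ₛ g)
*ₛ-respects {f = f} {g} rf rg = sumSplits-respects (λ β γ → f β * g γ) (λ eq₁ eq₂ → cong₂ _*_ (rf eq₁) (rg eq₂))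

prodₛ-respects : ∀ {n} k (F : ℕ → Series n) → (∀ i → Respects≗ (F i)) → Respects≗ (prodₛ k F)
prodₛ-respects zero    F rF = mono-respects (λ _ → 0)
prodₛ-respects (suc k) F rF = *ₛ-respects (prodₛ-respects k F rF) (rF k)

factor-respects : ∀ r n i → Respects≗ (factor r n i)
factor-respects r n i eq = cong₂ _-_ (mono-respects (λ _ → 0) eq) (mono-respects (factorExp r n i) eq)

≤ᵥᵇ-zero : ∀ {n} (α : Exp n) → ((λ _ → 0) ≤ᵥᵇ α) ≡ true
≤ᵥᵇ-zero {zero}  α = refl
≤ᵥᵇ-zero {suc n} α = ≤ᵥᵇ-zero (tail α)

*ₛ-identityʳ : ∀ {n} (h : Series n) → Respects≗ h → ∀ α → (h *ₛ oneₛ) α ≡ h α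
*ₛ-identityʳ h rh α = begin
  sumSplits α (λ β γ → h β * mono (λ _ → 0) γ)               ≡⟨ sumSplits-point α (λ _ → 0) (λ β γ → h β) (λ eq _ → rh eq) ⟩
  (if (λ _ → 0) ≤ᵥᵇ α then h (α ∸ᵥ (λ _ → 0)) else + 0)       ≡⟨ cong (λ b → if b then h (α ∸ᵥ (λ _ → 0)) else + 0) (≤ᵥᵇ-zero α) ⟩
  h (α ∸ᵥ (λ _ → 0))                                          ≡⟨ rh (λ _ → refl) ⟩
  h α                                                         ∎
  where open ≡-Reasoning

*ₛ-one-minus-mono : ∀ {n} (h : Series n) → Respects≗ h → ∀ v α →
  (h *ₛ (oneₛ -ₛ mono v)) α ≡ h α - (if v ≤ᵥᵇ α then h (α ∸ᵥ v) else + 0)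
*ₛ-one-minus-mono h rh v α = begin
  sumSplits α (λ β γ → h β * (mono (λ _ → 0) γ - mono v γ))
    ≡⟨ sumSplits-cong α (λ β γ → *-distribˡ-minus (h β) (mono (λ _ → 0) γ) (mono v γ)) ⟩
  sumSplits α (λ β γ → h β * mono (λ _ → 0) γ - h β * mono v γ)
    ≡⟨ sumSplits-minus α (λ β γ → h β * mono (λ _ → 0) γ) (λ β γ → h β * mono v γ) ⟩
  (h *ₛ oneₛ) α - sumSplits α (λ β γ → h β * mono v γ)
    ≡⟨ cong₂ _-_ (*ₛ-identityʳ h rh α) (sumSplits-point α v (λ β γ → h β) (λ eq _ → rh eq)) ⟩
  h α - (if v ≤ᵥᵇ α then h (α ∸ᵥ v) else + 0)
    ∎
  where open ≡-Reasoning

*ₛ-assoc-one-minus-mono : ∀ {n} (g h : Series n) → Respects≗ g → Respects≗ h → ∀ v α →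
  (g *ₛ (h *ₛ (oneₛ -ₛ mono v))) α ≡ ((g *ₛ h) *ₛ (oneₛ -ₛ mono v)) α
*ₛ-assoc-one-minus-mono g h rg rh v α = begin
  sumSplits α (λ β γ → g β * (h *ₛ (oneₛ -ₛ mono v)) γ)
    ≡⟨ sumSplits-cong α (λ β γ → trans (cong (g β *_) (*ₛ-one-minus-mono h rh v γ))
         (trans (*-distribˡ-minus (g β) (h γ) _) (cong (_-_ (g β * h γ)) (*-if (v ≤ᵥᵇ γ) (g β) (h (γ ∸ᵥ v)))))) ⟩
  sumSplits α (λ β γ → g β * h γ - (if v ≤ᵥᵇ γ then g β * h (γ ∸ᵥ v) else + 0))
    ≡⟨ sumSplits-minus α (λ β γ → g β * h γ) (λ β γ → if v ≤ᵥᵇ γ then g β * h (γ ∸ᵥ v) else + 0) ⟩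
  (g *ₛ h) α - sumSplits α (λ β γ → if v ≤ᵥᵇ γ then g β * h (γ ∸ᵥ v) else + 0)
    ≡⟨ cong (_-_ ((g *ₛ h) α)) (sumSplits-shift α v (λ β δ → g β * h δ) (λ eq₁ eq₂ → cong₂ _*_ (rg eq₁) (rh eq₂))) ⟩
  (g *ₛ h) α - (if v ≤ᵥᵇ α then (g *ₛ h) (α ∸ᵥ v) else + 0)
    ≡⟨ sym (*ₛ-one-minus-mono (g *ₛ h) (*ₛ-respects rg rh) v α) ⟩
  ((g *ₛ h) *ₛ (oneₛ -ₛ mono v)) α
    ∎
  where
  open ≡-Reasoning
  *-if : ∀ (p : Bool) (a x : ℤ) → a * (if p then x else + 0) ≡ (if p then a * x else + 0)
  *-if true  a x = refl
  *-if false a x = ZP.*-zeroʳ a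

-- Finite differences

Δ : (ℕ → ℤ) → ℕ → ℤ
Δ f j = f j - f (suc j)

Δⁿ : ℕ → (ℕ → ℤ) → ℕ → ℤ
Δⁿ zero    f = f
Δⁿ (suc t) f = Δ (Δⁿ t f)

Δⁿ-cong : ∀ t {f g : ℕ → ℤ} → (∀ j → f j ≡ g j) → ∀ j → Δⁿ t f j ≡ Δⁿ t g j
Δⁿ-cong zero    f≗g j = f≗g j
Δⁿ-cong (suc t) f≗g j = cong₂ _-_ (Δⁿ-cong t f≗g j) (Δⁿ-cong t f≗g (suc j))

Δⁿ-minus : ∀ t (f g : ℕ → ℤ) j → Δⁿ t (λ i → f i - g i) j ≡ Δⁿ t f j - Δⁿ t g j
Δⁿ-minus zero    f g j = refl
Δⁿ-minus (suc t) f g j = trans (cong₂ _-_ (Δⁿ-minus t f g j) (Δⁿ-minus t f g (suc j)))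
  (solve 4 (λ a b c d → (a :- b) :- (c :- d) := (a :- c) :- (b :- d)) refl
    (Δⁿ t f j) (Δⁿ t g j) (Δⁿ t f (suc j)) (Δⁿ t g (suc j)))

Δⁿ-zero : ∀ t j → Δⁿ t (λ _ → + 0) j ≡ + 0
Δⁿ-zero zero    j = refl
Δⁿ-zero (suc t) j = cong₂ _-_ (Δⁿ-zero t j) (Δⁿ-zero t (suc j))

Δⁿ-suc : ∀ t (f : ℕ → ℤ) j → Δⁿ (suc t) f j ≡ Δⁿ t (Δ f) j
Δⁿ-suc zero    f j = refl
Δⁿ-suc (suc t) f j = cong₂ _-_ (Δⁿ-suc t f j) (Δⁿ-suc t f (suc j))

VanishesFrom : ℕ → (ℕ → ℤ) → Set
VanishesFrom n f = ∀ j → n ≤ j → f j ≡ + 0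

Δⁿ-vanishesFrom : ∀ {n} t {f} → VanishesFrom n f → VanishesFrom n (Δⁿ t f)
Δⁿ-vanishesFrom zero    f0 = f0
Δⁿ-vanishesFrom (suc t) f0 j n≤j =
  cong₂ _-_ (Δⁿ-vanishesFrom t f0 j n≤j) (Δⁿ-vanishesFrom t f0 (suc j) (NP.m≤n⇒m≤1+n n≤j))

-- f is the sum of its differences from j up to n, where it vanishes.
Δ-nonneg⇒nonneg : ∀ n (f : ℕ → ℤ) → VanishesFrom n f → (∀ j → j < n → + 0 ≤ℤ Δ f j) →
  ∀ j → + 0 ≤ℤ f j
Δ-nonneg⇒nonneg n f f0 Δf≥0 j = go (n ∸ j) j (NP.m≤n+m∸n n j)
  where
  go : ∀ m j → n ≤ j ℕ.+ m → + 0 ≤ℤ f j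
  go m j n≤j+m with n ℕ.≤? j
  ... | yes n≤j = ZP.≤-reflexive (sym (f0 j n≤j))
  go zero    j n≤j+0 | no n≰j = ⊥-elim (n≰j (subst (n ≤_) (NP.+-identityʳ j) n≤j+0))
  go (suc m) j n≤j+m | no n≰j =
    subst (+ 0 ≤ℤ_) (solve 2 (λ a b → (a :- b) :+ b := a) refl (f j) (f (suc j)))
      (ZP.+-mono-≤ (Δf≥0 j (NP.≰⇒> n≰j)) (go m (suc j) (subst (n ≤_) (NP.+-suc j m) n≤j+m)))

Δⁿ-nonneg⇒lower-nonneg : ∀ n r (f : ℕ → ℤ) → VanishesFrom n f →
  (∀ j → j < n → + 0 ≤ℤ Δⁿ r f j) → ∀ t → t ≤ r → ∀ j → + 0 ≤ℤ Δⁿ t f j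
Δⁿ-nonneg⇒lower-nonneg n r f f0 Δʳf≥0 t t≤r = go (r ∸ t) t (NP.m+[n∸m]≡n t≤r)
  where
  go : ∀ u t → t ℕ.+ u ≡ r → ∀ j → + 0 ≤ℤ Δⁿ t f j
  go zero t t+0≡r j with n ℕ.≤? j
  ... | yes n≤j = ZP.≤-reflexive (sym (Δⁿ-vanishesFrom t f0 j n≤j))
  ... | no n≰j = subst (λ x → + 0 ≤ℤ Δⁿ x f j) (trans (sym t+0≡r) (NP.+-identityʳ t)) (Δʳf≥0 j (NP.≰⇒> n≰j))
  go (suc u) t t+u≡r =
    Δ-nonneg⇒nonneg n (Δⁿ t f) (Δⁿ-vanishesFrom t f0) (λ j _ → go u (suc t) (trans (sym (NP.+-suc t u)) t+u≡r) j)

sign-suc : ∀ j → sign (suc j) ≡ - sign j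
sign-suc zero          = refl
sign-suc (suc zero)    = refl
sign-suc (suc (suc j)) = sign-suc j

nC0≡1 : ∀ t → t C 0 ≡ 1
nC0≡1 t = trans (nCk≡nC[n∸k] {k = 0} {n = t} z≤n) (nCn≡1 t)

binomialSum : ℕ → (ℕ → ℤ) → ℕ → ℤ
binomialSum t f k = sumTo (suc t) (λ j → sign j * + (t C j) * f (k ℕ.+ j))

binomialSum-suc : ∀ t f k → binomialSum (suc t) f k ≡ binomialSum t f k - binomialSum t f (suc k)
binomialSum-suc t f k = begin
  binomialSum (suc t) f k
    ≡⟨ cong (_+_ first) (trans (sumTo-cong (suc t) pascal) (sumTo-+ (suc t) shifted unshifted)) ⟩
  first + (sumTo (suc t) shifted + sumTo (suc t) unshifted)
    ≡⟨ sym (ZP.+-assoc first _ _) ⟩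
  (first + sumTo (suc t) shifted) + sumTo (suc t) unshifted
    ≡⟨ cong₂ _+_ lower upper ⟩
  binomialSum t f k - binomialSum t f (suc k)
    ∎
  where
  open ≡-Reasoning
  term : ℕ → ℤ
  term j = sign j * + (t C j) * f (k ℕ.+ j)
  first : ℤ
  first = sign 0 * + (suc t C 0) * f (k ℕ.+ 0)
  shifted unshifted : ℕ → ℤ
  shifted j = term (suc j)
  unshifted j = sign (suc j) * + (t C j) * f (k ℕ.+ suc j)
  pascal : ∀ j → sign (suc j) * + (suc t C suc j) * f (k ℕ.+ suc j) ≡ shifted j + unshifted j
  pascal j = begin
    sign (suc j) * + (suc t C suc j) * f (k ℕ.+ suc j)
      ≡⟨ cong (λ c → sign (suc j) * + c * f (k ℕ.+ suc j)) (sym (nCk+nC[k+1]≡[n+1]C[k+1] t j)) ⟩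
    sign (suc j) * + (t C j ℕ.+ t C suc j) * f (k ℕ.+ suc j)
      ≡⟨ cong (λ c → sign (suc j) * c * f (k ℕ.+ suc j)) (ZP.pos-+ (t C j) (t C suc j)) ⟩
    sign (suc j) * (+ (t C j) + + (t C suc j)) * f (k ℕ.+ suc j)
      ≡⟨ solve 4 (λ s a b x → s :* (a :+ b) :* x := s :* b :* x :+ s :* a :* x) refl
           (sign (suc j)) (+ (t C j)) (+ (t C suc j)) (f (k ℕ.+ suc j)) ⟩
    shifted j + unshifted j
      ∎
  lower : first + sumTo (suc t) shifted ≡ binomialSum t f k
  lower = begin
    first + sumTo (suc t) shifted
      ≡⟨ cong (λ c → sign 0 * + c * f (k ℕ.+ 0) + sumTo (suc t) shifted) (trans (nC0≡1 (suc t)) (sym (nC0≡1 t))) ⟩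
    sumTo (suc (suc t)) term
      ≡⟨ sumTo-snoc (suc t) term ⟩
    binomialSum t f k + term (suc t)
      ≡⟨ cong (λ c → binomialSum t f k + sign (suc t) * + c * f (k ℕ.+ suc t)) (k>n⇒nCk≡0 (NP.n<1+n t)) ⟩
    binomialSum t f k + sign (suc t) * + 0 * f (k ℕ.+ suc t)
      ≡⟨ solve 3 (λ b s x → b :+ s :* con (+ 0) :* x := b) refl
           (binomialSum t f k) (sign (suc t)) (f (k ℕ.+ suc t)) ⟩
    binomialSum t f k
      ∎
  upper : sumTo (suc t) unshifted ≡ - binomialSum t f (suc k)
  upper = trans (sumTo-cong (suc t) negate) (sumTo-neg (suc t) (λ j → sign j * + (t C j) * f (suc k ℕ.+ j)))
    where
    negate : ∀ j → unshifted j ≡ - (sign j * + (t C j) * f (suc k ℕ.+ j))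
    negate j = trans (cong₂ (λ s x → s * + (t C j) * f x) (sign-suc j) (NP.+-suc k j))
      (solve 3 (λ s c x → (:- s) :* c :* x := :- (s :* c :* x)) refl (sign j) (+ (t C j)) (f (suc k ℕ.+ j)))

binomialSum≡Δⁿ : ∀ t f k → binomialSum t f k ≡ Δⁿ t f k
binomialSum≡Δⁿ zero    f k = trans (ZP.+-identityʳ _) (trans (ZP.*-identityˡ _) (cong f (NP.+-identityʳ k)))
binomialSum≡Δⁿ (suc t) f k =
  trans (binomialSum-suc t f k) (cong₂ _-_ (binomialSum≡Δⁿ t f k) (binomialSum≡Δⁿ t f (suc k)))

ext-cong : ∀ {n} {l m : Fin n → ℤ} → l ≗ m → ∀ j → ext l j ≡ ext m j
ext-cong {zero}  l≗m j       = refl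
ext-cong {suc n} l≗m zero    = l≗m zero
ext-cong {suc n} l≗m (suc j) = ext-cong (l≗m ∘ suc) j

ext-vanishesFrom : ∀ {n} (l : Fin n → ℤ) → VanishesFrom n (ext l)
ext-vanishesFrom {zero}  l j       n≤j       = refl
ext-vanishesFrom {suc n} l (suc j) (s≤s n≤j) = ext-vanishesFrom (l ∘ suc) j n≤j

ext-toℕ : ∀ {n} (l : Fin n → ℤ) i → ext l (toℕ i) ≡ l i
ext-toℕ l zero    = refl
ext-toℕ l (suc i) = ext-toℕ (l ∘ suc) i

ext-minus : ∀ {n} (l m : Fin n → ℤ) j → ext (λ i → l i - m i) j ≡ ext l j - ext m j
ext-minus {zero}  l m j       = refl
ext-minus {suc n} l m zero    = refl
ext-minus {suc n} l m (suc j) = ext-minus (l ∘ suc) (m ∘ suc) j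

ext-tabulate : ∀ n (h : ℕ → ℤ) → VanishesFrom n h → ∀ j → ext {n} (h ∘ toℕ) j ≡ h j
ext-tabulate zero    h h0 j       = sym (h0 j z≤n)
ext-tabulate (suc n) h h0 zero    = refl
ext-tabulate (suc n) h h0 (suc j) = ext-tabulate n (h ∘ suc) (λ j n≤j → h0 (suc j) (s≤s n≤j)) j

diffSum≡Δⁿ : ∀ {n} (l : Fin n → ℤ) k t → diffSum l (suc k) t ≡ Δⁿ t (ext l) k
diffSum≡Δⁿ l k t =
  trans (sumℤ-upTo (λ j → sign j * + (t C j) * ext l (k ℕ.+ j)) (suc t)) (binomialSum≡Δⁿ t (ext l) k)

-- Only the top order t = r matters: the lower ones follow because λ vanishes beyond n.
InP⇔Δⁿ-nonneg : ∀ s {n} (l : Fin n → ℤ) →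
  InP (suc s) l ⇔ (∀ j → j < n → + 0 ≤ℤ Δⁿ (suc s) (ext l) j)
InP⇔Δⁿ-nonneg s {n} l = mk⇔ top all-orders
  where
  top : InP (suc s) l → ∀ j → j < n → + 0 ≤ℤ Δⁿ (suc s) (ext l) j
  top l∈P j j<n = subst₂ (λ t k → + 0 ≤ℤ Δⁿ (suc t) (ext l) k) (FP.toℕ-fromℕ s) (FP.toℕ-fromℕ< j<n)
    (subst (+ 0 ≤ℤ_) (diffSum≡Δⁿ l (toℕ (fromℕ< j<n)) (suc (toℕ (fromℕ s)))) (l∈P (fromℕ< j<n) (fromℕ s)))
  all-orders : (∀ j → j < n → + 0 ≤ℤ Δⁿ (suc s) (ext l) j) → InP (suc s) l
  all-orders Δʳ≥0 k t = subst (+ 0 ≤ℤ_) (sym (diffSum≡Δⁿ l (toℕ k) (suc (toℕ t))))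
    (Δⁿ-nonneg⇒lower-nonneg n (suc s) (ext l) (ext-vanishesFrom l) Δʳ≥0 (suc (toℕ t)) (FP.toℕ<n t) (toℕ k))

Δⁿ-nonneg⇒nonneg : ∀ s {n} (l : Fin n → ℤ) →
  (∀ j → j < n → + 0 ≤ℤ Δⁿ (suc s) (ext l) j) → ∀ i → + 0 ≤ℤ l i
Δⁿ-nonneg⇒nonneg s {n} l Δʳ≥0 i = subst (+ 0 ≤ℤ_) (ext-toℕ l i)
  (Δⁿ-nonneg⇒lower-nonneg n (suc s) (ext l) (ext-vanishesFrom l) Δʳ≥0 0 z≤n (toℕ i))

InP⇒nonneg : ∀ s {n} (l : Fin n → ℤ) → InP (suc s) l → ∀ i → + 0 ≤ℤ l i
InP⇒nonneg s l = Δⁿ-nonneg⇒nonneg s l ∘ to (InP⇔Δⁿ-nonneg s l)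

diffSum-cong : ∀ {n} {l m : Fin n → ℤ} → l ≗ m → ∀ k t → diffSum l k t ≡ diffSum m k t
diffSum-cong l≗m k t = cong sumℤ (LP.map-cong
  (λ j → cong (sign j * + (t C j) *_) (ext-cong l≗m (k ∸ 1 ℕ.+ j))) (upTo (suc t)))

InP-cong : ∀ r {n} {l m : Fin n → ℤ} → l ≗ m → InP r l → InP r m
InP-cong r l≗m l∈P k t = subst (+ 0 ≤ℤ_) (diffSum-cong l≗m (suc (toℕ k)) (suc (toℕ t))) (l∈P k t)

lhsSeries-respects : ∀ r n → Respects≗ (lhsSeries r n)
lhsSeries-respects r n {α} {α'} α≗α' = cong indicator (does-⇔
  (mk⇔ (InP-cong r (cong +_ ∘ α≗α')) (InP-cong r (cong +_ ∘ sym ∘ α≗α')))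
  (InP? r (toℤ α)) (InP? r (toℤ α')))

kronecker : ℕ → ℕ → ℕ
kronecker k j = if j ≡ᵇ k then 1 else 0

-- factorExp (suc s) n k is the restriction of column s k to m < n.
column : ℕ → ℕ → ℕ → ℕ
column s k m = if m ≤ᵇ k then (s ℕ.+ (k ∸ m)) C s else 0

column-zero-telescopes : ∀ k j → column 0 k j ≡ kronecker k j ℕ.+ column 0 k (suc j)
column-zero-telescopes k j with ℕ.<-cmp j k
... | tri< j<k _ _ rewrite ≤ᵇ-true (NP.<⇒≤ j<k) | ≤ᵇ-true j<k | ≡ᵇ-false (NP.<⇒≢ j<k)
  = trans (nC0≡1 (k ∸ j)) (sym (nC0≡1 (k ∸ suc j)))
... | tri≈ _ refl _ rewrite ≤ᵇ-true (NP.≤-refl {j}) | ≤ᵇ-false (NP.n≮n j) | ≡ᵇ-true {j} refl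
  = nC0≡1 (j ∸ j)
... | tri> _ _ k<j rewrite ≤ᵇ-false (NP.<⇒≱ k<j) | ≤ᵇ-false (NP.<⇒≱ (NP.m<n⇒m<1+n k<j)) | ≡ᵇ-false (NP.>⇒≢ k<j)
  = refl

column-pascal : ∀ s k j → column (suc s) k j ≡ column s k j ℕ.+ column (suc s) k (suc j)
column-pascal s k j with ℕ.<-cmp j k
... | tri< j<k _ _ rewrite ≤ᵇ-true (NP.<⇒≤ j<k) | ≤ᵇ-true j<k | NP.+-∸-assoc 1 j<k
  = sym (trans (cong (λ m → (s ℕ.+ suc d) C s ℕ.+ m C suc s) (sym (NP.+-suc s d)))
               (nCk+nC[k+1]≡[n+1]C[k+1] (s ℕ.+ suc d) s))
  where
  d : ℕ
  d = k ∸ suc j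
... | tri≈ _ refl _ rewrite ≤ᵇ-true (NP.≤-refl {j}) | ≤ᵇ-false (NP.n≮n j) | NP.n∸n≡0 j
                          | NP.+-identityʳ s | nCn≡1 s | nCn≡1 (suc s)
  = refl
... | tri> _ _ k<j rewrite ≤ᵇ-false (NP.<⇒≱ k<j) | ≤ᵇ-false (NP.<⇒≱ (NP.m<n⇒m<1+n k<j))
  = refl

Δ-telescoping : ∀ (g h : ℕ → ℕ) j → g j ≡ h j ℕ.+ g (suc j) → Δ (+_ ∘ g) j ≡ + h j
Δ-telescoping g h j eq = begin
  + g j - + g (suc j)                 ≡⟨ cong (λ m → + m - + g (suc j)) eq ⟩
  + (h j ℕ.+ g (suc j)) - + g (suc j) ≡⟨ cong (_- + g (suc j)) (ZP.pos-+ (h j) (g (suc j))) ⟩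
  + h j + + g (suc j) - + g (suc j)   ≡⟨ solve 2 (λ a b → a :+ b :- b := a) refl (+ h j) (+ g (suc j)) ⟩
  + h j                               ∎
  where open ≡-Reasoning

Δⁿ-column : ∀ s k j → Δⁿ (suc s) (+_ ∘ column s k) j ≡ + kronecker k j
Δⁿ-column zero    k j = Δ-telescoping (column 0 k) (kronecker k) j (column-zero-telescopes k j)
Δⁿ-column (suc s) k j =
  trans (Δⁿ-suc (suc s) (+_ ∘ column (suc s) k) j)
    (trans (Δⁿ-cong (suc s) (λ i → Δ-telescoping (column (suc s) k) (column s k) i (column-pascal s k i)) j)
      (Δⁿ-column s k j))

Δⁿ-factorExp : ∀ s n k → k < n → ∀ j →
  Δⁿ (suc s) (ext (toℤ (factorExp (suc s) n k))) j ≡ + kronecker k j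
Δⁿ-factorExp s n k k<n j =
  trans (Δⁿ-cong (suc s) (ext-tabulate n (+_ ∘ column s k) beyond) j) (Δⁿ-column s k j)
  where
  beyond : VanishesFrom n (+_ ∘ column s k)
  beyond j n≤j rewrite ≤ᵇ-false (NP.<⇒≱ (NP.<-≤-trans k<n n≤j)) = refl

-- The coordinates Δ^r λ

+-minus-nonneg⇒≤ : ∀ a b → + 0 ≤ℤ + a - + b → b ≤ a
+-minus-nonneg⇒≤ a b = ZP.drop‿+≤+ ∘ ZP.0≤i-j⇒j≤i

pos-∸ : ∀ {a b} → b ≤ a → + (a ∸ b) ≡ + a - + b
pos-∸ {a} {b} b≤a = sym (trans (ZP.m-n≡m⊖n a b) (ZP.⊖-≥ b≤a))

0≤i∧i≢0⇒0≤i-1 : ∀ {i} → + 0 ≤ℤ i → i ≢ + 0 → + 0 ≤ℤ i - + 1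
0≤i∧i≢0⇒0≤i-1 {+ zero}  _ i≢0 = ⊥-elim (i≢0 refl)
0≤i∧i≢0⇒0≤i-1 {+ suc i} _ _   = ℤ.+≤+ z≤n

kronecker-self : ∀ k → kronecker k k ≡ 1
kronecker-self k rewrite ≡ᵇ-true {k} refl = refl

kronecker-≢ : ∀ {k j} → j ≢ k → kronecker k j ≡ 0
kronecker-≢ j≢k rewrite ≡ᵇ-false j≢k = refl

module Coordinates (s n : ℕ) where

  coordℤ : (Fin n → ℤ) → ℕ → ℤ
  coordℤ l = Δⁿ (suc s) (ext l)

  coord : Exp n → ℕ → ℤ
  coord α = coordℤ (toℤ α)

  generator : ℕ → Exp n
  generator = factorExp (suc s) n

  coordℤ-minus : ∀ (l m : Fin n → ℤ) j → coordℤ (λ i → l i - m i) j ≡ coordℤ l j - coordℤ m j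
  coordℤ-minus l m j = trans (Δⁿ-cong (suc s) (ext-minus l m) j) (Δⁿ-minus (suc s) (ext l) (ext m) j)

  coordℤ-zero : ∀ j → coordℤ (λ _ → + 0) j ≡ + 0
  coordℤ-zero j = trans (Δⁿ-cong (suc s) (ext-tabulate n (λ _ → + 0) (λ _ _ → refl)) j) (Δⁿ-zero (suc s) j)

  coordℤ-minus-generator : ∀ {k} → k < n → ∀ α j →
    coordℤ (λ i → + α i - + generator k i) j ≡ coord α j - + kronecker k j
  coordℤ-minus-generator k<n α j =
    trans (coordℤ-minus (toℤ α) (toℤ (generator _)) j) (cong (_-_ (coord α j)) (Δⁿ-factorExp s n _ k<n j))

  coord-∸-generator : ∀ {k} → k < n → ∀ {α} → generator k ≤ᵥ α → ∀ j →
    coord (α ∸ᵥ generator k) j ≡ coord α j - + kronecker k j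
  coord-∸-generator k<n {α} v≤α j =
    trans (Δⁿ-cong (suc s) (ext-cong (λ i → pos-∸ (v≤α i))) j) (coordℤ-minus-generator k<n α j)

  generator-≤ᵥ : ∀ {k} → k < n → ∀ α → (∀ j → j < n → + 0 ≤ℤ coord α j - + kronecker k j) →
    generator k ≤ᵥ α
  generator-≤ᵥ k<n α ≥0 i = +-minus-nonneg⇒≤ (α i) _
    (Δⁿ-nonneg⇒nonneg s _ (λ j j<n → subst (+ 0 ≤ℤ_) (sym (coordℤ-minus-generator k<n α j)) (≥0 j j<n)) i)

  AdmissibleAt : ℕ → Exp n → ℕ → Set
  AdmissibleAt k α j = (+ 0 ≤ℤ coord α j) × (j < k → coord α j ≡ + 0)

  Admissible : ℕ → Exp n → Set
  Admissible k α = ∀ j → j < n → AdmissibleAt k α j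

  admissible? : ∀ k α → Dec (Admissible k α)
  admissible? k α = Dec.map (mk⇔ fromFin toFin) (FP.all? λ i → admissibleAt? (toℕ i))
    where
    admissibleAt? : ∀ j → Dec (AdmissibleAt k α j)
    admissibleAt? j = (+ 0 ZP.≤? coord α j) ×-dec ((j ℕ.<? k) →-dec (coord α j ZP.≟ + 0))
    fromFin : (∀ i → AdmissibleAt k α (toℕ i)) → Admissible k α
    fromFin h j j<n = subst (AdmissibleAt k α) (FP.toℕ-fromℕ< j<n) (h (fromℕ< j<n))
    toFin : Admissible k α → ∀ i → AdmissibleAt k α (toℕ i)
    toFin h i = h (toℕ i) (FP.toℕ<n i)

  InP⇔Admissible-zero : ∀ α → InP (suc s) (toℤ α) ⇔ Admissible 0 α
  InP⇔Admissible-zero α = mk⇔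
    (λ α∈P j j<n → to (InP⇔Δⁿ-nonneg s (toℤ α)) α∈P j j<n , λ ())
    (λ adm → from (InP⇔Δⁿ-nonneg s (toℤ α)) (λ j j<n → proj₁ (adm j j<n)))

  Admissible-all⇔zero : ∀ α → Admissible n α ⇔ α ≗ (λ _ → 0)
  Admissible-all⇔zero α = mk⇔ vanishes admissible
    where
    vanishes : Admissible n α → α ≗ (λ _ → 0)
    vanishes adm i = NP.n≤0⇒n≡0 (+-minus-nonneg⇒≤ 0 (α i)
      (Δⁿ-nonneg⇒nonneg s (λ i → + 0 - + α i) (λ j j<n → ZP.≤-reflexive (sym (begin
        coordℤ (λ i → + 0 - + α i) j          ≡⟨ coordℤ-minus (λ _ → + 0) (toℤ α) j ⟩
        coordℤ (λ _ → + 0) j - coord α j      ≡⟨ cong₂ _-_ (coordℤ-zero j) (proj₂ (adm j j<n) j<n) ⟩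
        + 0                                   ∎))) i))
      where open ≡-Reasoning
    admissible : α ≗ (λ _ → 0) → Admissible n α
    admissible α≗0 j _ = ZP.≤-reflexive (sym coord≡0) , λ _ → coord≡0
      where
      coord≡0 : coord α j ≡ + 0
      coord≡0 = trans (Δⁿ-cong (suc s) (ext-cong (cong +_ ∘ α≗0)) j) (coordℤ-zero j)

  Admissible-suc⇒Admissible : ∀ {k α} → Admissible (suc k) α → Admissible k α
  Admissible-suc⇒Admissible adm j j<n = proj₁ (adm j j<n) , proj₂ (adm j j<n) ∘ NP.m<n⇒m<1+n

  module _ {k} (k<n : k < n) {α : Exp n} where

    private
      v = generator k

    Admissible-after-generator⇒Admissible : v ≤ᵥ α → Admissible k (α ∸ᵥ v) → Admissible k α
    Admissible-after-generator⇒Admissible v≤α adm j j<n =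
      subst (+ 0 ≤ℤ_) (sym restore) (ZP.+-mono-≤ (proj₁ (adm j j<n)) (ℤ.+≤+ z≤n)) ,
      λ j<k → trans restore (cong₂ _+_ (proj₂ (adm j j<n) j<k) (cong +_ (kronecker-≢ (NP.<⇒≢ j<k))))
      where
      restore : coord α j ≡ coord (α ∸ᵥ v) j + + kronecker k j
      restore = trans (solve 2 (λ c e → c := (c :- e) :+ e) refl (coord α j) (+ kronecker k j))
                      (cong (_+ + kronecker k j) (sym (coord-∸-generator k<n v≤α j)))

    Admissible-suc⇒¬Admissible-after-generator : Admissible (suc k) α → v ≤ᵥ α → ¬ Admissible k (α ∸ᵥ v)
    Admissible-suc⇒¬Admissible-after-generator adm v≤α adm′ =
      ¬0≤-1 (subst (+ 0 ≤ℤ_) coord-after (proj₁ (adm′ k k<n)))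
      where
      ¬0≤-1 : ¬ (+ 0 ≤ℤ + 0 - + 1)
      ¬0≤-1 ()
      coord-after : coord (α ∸ᵥ v) k ≡ + 0 - + 1
      coord-after = trans (coord-∸-generator k<n v≤α k)
        (cong₂ _-_ (proj₂ (adm k k<n) (NP.n<1+n k)) (cong +_ (kronecker-self k)))

    Admissible∧¬Admissible-suc⇒after-generator : Admissible k α → ¬ Admissible (suc k) α →
      Σ[ v≤α ∈ v ≤ᵥ α ] Admissible k (α ∸ᵥ v)
    Admissible∧¬Admissible-suc⇒after-generator adm ¬adm-suc = v≤α , adm′
      where
      coord-k≢0 : coord α k ≢ + 0
      coord-k≢0 coord≡0 = ¬adm-suc λ j j<n → proj₁ (adm j j<n) , λ j<1+k →
        Sum.[ proj₂ (adm j j<n) , (λ { refl → coord≡0 }) ] (NP.m<1+n⇒m<n∨m≡n j<1+k)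
      coord-minus-kronecker : ∀ j → j < n → + 0 ≤ℤ coord α j - + kronecker k j
      coord-minus-kronecker j j<n with j ℕ.≟ k
      ... | yes refl rewrite kronecker-self j = 0≤i∧i≢0⇒0≤i-1 (proj₁ (adm j j<n)) coord-k≢0
      ... | no j≢k rewrite kronecker-≢ j≢k | ZP.+-identityʳ (coord α j) = proj₁ (adm j j<n)
      v≤α : v ≤ᵥ α
      v≤α = generator-≤ᵥ k<n α coord-minus-kronecker
      adm′ : Admissible k (α ∸ᵥ v)
      adm′ j j<n = subst (+ 0 ≤ℤ_) (sym (coord-∸-generator k<n v≤α j)) (coord-minus-kronecker j j<n) ,
        λ j<k → begin
          coord (α ∸ᵥ v) j              ≡⟨ coord-∸-generator k<n v≤α j ⟩
          coord α j - + kronecker k j   ≡⟨ cong (λ e → coord α j - + e) (kronecker-≢ (NP.<⇒≢ j<k)) ⟩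
          coord α j - + 0               ≡⟨ ZP.+-identityʳ (coord α j) ⟩
          coord α j                     ≡⟨ proj₂ (adm j j<n) j<k ⟩
          + 0                           ∎
        where open ≡-Reasoning

  shiftedIndicator : ℕ → Exp n → ℤ
  shiftedIndicator k α =
    if generator k ≤ᵥᵇ α then indicator (does (admissible? k (α ∸ᵥ generator k))) else + 0

  shiftedIndicator≡0 : ∀ {k α} → (generator k ≤ᵥ α → ¬ Admissible k (α ∸ᵥ generator k)) →
    shiftedIndicator k α ≡ + 0
  shiftedIndicator≡0 {k} {α} ¬adm′ with generator k ≤ᵥᵇ α | ≤ᵥᵇ-reflects (generator k) α
  ... | false | _        = refl
  ... | true  | ofʸ v≤α = cong indicator (dec-false (admissible? k (α ∸ᵥ generator k)) (¬adm′ v≤α))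

  shiftedIndicator≡1 : ∀ {k α} → Σ[ v≤α ∈ generator k ≤ᵥ α ] Admissible k (α ∸ᵥ generator k) →
    shiftedIndicator k α ≡ + 1
  shiftedIndicator≡1 {k} {α} (v≤α , adm′) with generator k ≤ᵥᵇ α | ≤ᵥᵇ-reflects (generator k) α
  ... | true  | _        = cong indicator (dec-true (admissible? k (α ∸ᵥ generator k)) adm′)
  ... | false | ofⁿ v≰α = ⊥-elim (v≰α v≤α)

  indicator-step : ∀ {k} → k < n → ∀ α →
    indicator (does (admissible? k α)) - shiftedIndicator k α ≡ indicator (does (admissible? (suc k) α))
  indicator-step {k} k<n α = step (admissible? k α) (admissible? (suc k) α)
    where
    step : (adm? : Dec (Admissible k α)) (adm-suc? : Dec (Admissible (suc k) α)) →
      indicator (does adm?) - shiftedIndicator k α ≡ indicator (does adm-suc?)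
    step (yes adm) (yes adm-suc) =
      cong (_-_ (+ 1)) (shiftedIndicator≡0 (Admissible-suc⇒¬Admissible-after-generator k<n adm-suc))
    step (yes adm) (no ¬adm-suc) =
      cong (_-_ (+ 1)) (shiftedIndicator≡1 (Admissible∧¬Admissible-suc⇒after-generator k<n adm ¬adm-suc))
    step (no ¬adm) (yes adm-suc) = ⊥-elim (¬adm (Admissible-suc⇒Admissible adm-suc))
    step (no ¬adm) (no ¬adm-suc) =
      cong (_-_ (+ 0)) (shiftedIndicator≡0 (λ v≤α → ¬adm ∘ Admissible-after-generator⇒Admissible k<n v≤α))

  private
    L : Series n
    L = lhsSeries (suc s) n
    L-respects : Respects≗ L
    L-respects = lhsSeries-respects (suc s) n

  partialProduct : ∀ k → k ≤ n → ∀ α → (L *ₛ prodₛ k (factor (suc s) n)) α ≡ indicator (does (admissible? k α))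
  partialProduct zero    _     α = trans (*ₛ-identityʳ L L-respects α)
    (cong indicator (does-⇔ (InP⇔Admissible-zero α) (InP? (suc s) (toℤ α)) (admissible? 0 α)))
  partialProduct (suc k) k<n α = begin
    (L *ₛ (P *ₛ factor (suc s) n k)) α
      ≡⟨ *ₛ-assoc-one-minus-mono L P L-respects P-respects v α ⟩
    ((L *ₛ P) *ₛ factor (suc s) n k) α
      ≡⟨ *ₛ-one-minus-mono (L *ₛ P) (*ₛ-respects L-respects P-respects) v α ⟩
    (L *ₛ P) α - (if v ≤ᵥᵇ α then (L *ₛ P) (α ∸ᵥ v) else + 0)
      ≡⟨ cong₂ _-_ (partialProduct k k≤n α) (if-cong (v ≤ᵥᵇ α) (partialProduct k k≤n (α ∸ᵥ v))) ⟩
    indicator (does (admissible? k α)) - shiftedIndicator k α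
      ≡⟨ indicator-step k<n α ⟩
    indicator (does (admissible? (suc k) α))
      ∎
    where
    open ≡-Reasoning
    v : Exp n
    v = generator k
    P : Series n
    P = prodₛ k (factor (suc s) n)
    P-respects : Respects≗ P
    P-respects = prodₛ-respects k (factor (suc s) n) (factor-respects (suc s) n)
    k≤n : k ≤ n
    k≤n = NP.<⇒≤ k<n

mainTheorem1 : (r n : ℕ) → 1 ≤ r → 1 ≤ n →
    ((λ' : Fin n → ℤ) → InP r λ' → (i : Fin n) → + 0 ≤ℤ λ' i)
    × ((lhsSeries r n *ₛ prodₛ n (factor r n)) ≈ₛ oneₛ)
mainTheorem1 (suc s) n _ _ = InP⇒nonneg s , λ α → begin
  (lhsSeries (suc s) n *ₛ prodₛ n (factor (suc s) n)) α  ≡⟨ partialProduct n NP.≤-refl α ⟩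
  indicator (does (admissible? n α))                     ≡⟨ cong indicator (does-⇔ (Admissible-all⇔zero α)
                                                              (admissible? n α) (_ because eqVecᵇ-reflects α (λ _ → 0))) ⟩
  oneₛ α                                                 ∎
  where
  open ≡-Reasoning
  open Coordinates s n
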